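{- For every positive integer $n$, $$\Phi_3(n)\le (4n)^{1/3}+1.$$
   Context: A finite set of non-negative integers is a $B_3$-sequence if all sums of three of its elements (repetitions allowed) are different, i.e. whenever $x_1+x_2+x_3=y_1+y_2+y_3$ with all $x_i,y_i$ in the set, the multisets $\{x_1,x_2,x_3\}$ and $\{y_1,y_2,y_3\}$ coincide. For a positive integer $n$, $\Phi_3(n)$ denotes the maximum size of a $B_3$-sequence contained in $[0,n]$. -}

module Defs where

open import Data.Nat using (ℕ; _+_; _≤_)
open import Data.List using (List; _∷_; [])
open import Data.List.Membership.Propositional using (_∈_)
open import Data.List.Relation.Unary.All using (All)
open import Data.List.Relation.Binary.Permutation.Propositional using (_↭_)
open import Relation.Binary.PropositionalEquality using (_≡_)

-- A finite set of naturals is represented as a duplicate-free list (Unique).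
IsB₃ : List ℕ → Set
IsB₃ A = ∀ {x₁ x₂ x₃ y₁ y₂ y₃} →
  x₁ ∈ A → x₂ ∈ A → x₃ ∈ A → y₁ ∈ A → y₂ ∈ A → y₃ ∈ A →
  x₁ + x₂ + x₃ ≡ y₁ + y₂ + y₃ →
  (x₁ ∷ x₂ ∷ x₃ ∷ []) ↭ (y₁ ∷ y₂ ∷ y₃ ∷ [])

InRange : ℕ → List ℕ → Set
InRange n A = All (_≤ n) A

-- Let k = |A| and count the triples T = #{(x, y, z) ∈ A³ : z ≤ x + y ≤ z + n}.
--
-- From above, T ≤ Σ_{v=0}^{n} #{(x, y, z) ∈ A³ : x + y = z + v}. The B₃ property gives every s at
-- most two ordered representations s = x + y, and for v ∉ A at most one z ∈ A with z + v
-- representable; so the v-th term is at most 2, or 2k when v ∈ A, and T ≤ 2(n + 1) + 2k(k − 1).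
--
-- From below, fix y ∈ A. Counting (x, z) together with (z, x), the pairs admitted for this y have
-- total weight Σ_{x,z ∈ A} w ∣x − z∣ with w d = [d ≤ y] + [d ≤ n − y]. This weight is at least
-- k(k + 1): peel the extreme elements of A off an interval around y, only the far end while the
-- other end is y itself, both ends otherwise, using w d₁ + w d₂ ≥ 2 whenever d₁ + d₂ ≤ n (and
-- ≥ 3 when the inner point is y). Hence 2T ≥ k²(k + 1), and the two bounds give (k − 1)³ ≤ 4n.

module Submission where

open import Defs
open import Data.Nat using (ℕ; suc; _∸_; _^_; _*_; _≤_)
open import Data.List using (List; length)
open import Data.List.Relation.Unary.Unique.Propositional using (Unique)
open import Data.Nat using (zero; _+_; _<_; z≤n; s≤s; s≤s⁻¹; z<s; ∣_-_∣)
open import Data.Nat.Properties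
open import Data.Nat.ListAction using (sum)
open import Data.Nat.ListAction.Properties using (sum-↭)
open import Data.Nat.Tactic.RingSolver using (solve-∀)
open import Data.List using ([]; _∷_; map; filter; upTo)
open import Data.List.Properties using (filter-none; filter-all; length-applyUpTo)
open import Data.List.Relation.Unary.All as All using (All; []; _∷_)
open import Data.List.Relation.Unary.AllPairs using ([]; _∷_)
open import Data.List.Relation.Unary.Any using (here; there)
open import Data.List.Membership.Propositional using (_∈_; _∉_)
open import Data.List.Membership.Propositional.Properties using (∈-filter⁻; ∈-filter⁺; ∈-upTo⁺)
open import Data.List.Membership.DecPropositional _≟_ using (_∈?_)
open import Data.List.Relation.Binary.Permutation.Propositional
  using (_↭_; ↭-refl; ↭-reflexive; ↭-prep; ↭-swap; ↭-trans; ↭-sym)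
open import Data.List.Relation.Binary.Permutation.Propositional.Properties
  using (map⁺; ↭-length; ∈-resp-↭)
open import Data.List.Relation.Unary.Unique.Propositional.Properties using (upTo⁺)
open import Data.Product using (∃; ∃₂; _×_; _,_; proj₁; proj₂)
open import Data.Sum using (_⊎_; inj₁; inj₂)
open import Function using (_∘_; id; _⇔_; mk⇔; Equivalence)
open import Relation.Nullary using (Dec; yes; no; ¬_; contradiction)
open import Relation.Nullary.Decidable using (_×-dec_)
open import Relation.Unary using (Pred; Decidable)
open import Relation.Binary.PropositionalEquality

∑ : List ℕ → (ℕ → ℕ) → ℕ
∑ xs f = sum (map f xs)

syntax ∑ xs (λ x → e) = ∑[ x ∈ xs ] e

∑-+ : ∀ xs (f g : ℕ → ℕ) → ∑[ x ∈ xs ] (f x + g x) ≡ ∑ xs f + ∑ xs g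
∑-+ []       f g = refl
∑-+ (x ∷ xs) f g =
  trans (cong (f x + g x +_) (∑-+ xs f g)) (interchange (f x) (g x) (∑ xs f) (∑ xs g))
  where
  interchange : ∀ a b c d → a + b + (c + d) ≡ a + c + (b + d)
  interchange = solve-∀

∑-*ˡ : ∀ xs c (f : ℕ → ℕ) → ∑[ x ∈ xs ] (c * f x) ≡ c * ∑ xs f
∑-*ˡ []       c f = sym (*-zeroʳ c)
∑-*ˡ (x ∷ xs) c f =
  trans (cong (c * f x +_) (∑-*ˡ xs c f)) (sym (*-distribˡ-+ c (f x) (∑ xs f)))

∑-const : ∀ xs c → ∑[ x ∈ xs ] c ≡ length xs * c
∑-const []       c = refl
∑-const (x ∷ xs) c = cong (c +_) (∑-const xs c)

∑-cong : ∀ xs {f g : ℕ → ℕ} → (∀ {x} → x ∈ xs → f x ≡ g x) → ∑ xs f ≡ ∑ xs g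
∑-cong []       eq = refl
∑-cong (x ∷ xs) eq = cong₂ _+_ (eq (here refl)) (∑-cong xs (eq ∘ there))

∑-mono-≤ : ∀ xs {f g : ℕ → ℕ} → (∀ {x} → x ∈ xs → f x ≤ g x) → ∑ xs f ≤ ∑ xs g
∑-mono-≤ []       le = z≤n
∑-mono-≤ (x ∷ xs) le = +-mono-≤ (le (here refl)) (∑-mono-≤ xs (le ∘ there))

∑-comm : ∀ xs ys (f : ℕ → ℕ → ℕ) → ∑[ x ∈ xs ] ∑ ys (f x) ≡ ∑[ y ∈ ys ] ∑[ x ∈ xs ] f x y
∑-comm []       ys f = sym (trans (∑-const ys 0) (*-zeroʳ (length ys)))
∑-comm (x ∷ xs) ys f =
  trans (cong (∑ ys (f x) +_) (∑-comm xs ys f)) (sym (∑-+ ys (f x) λ y → ∑[ x ∈ xs ] f x y))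

∑-↭ : ∀ {xs ys} (f : ℕ → ℕ) → xs ↭ ys → ∑ xs f ≡ ∑ ys f
∑-↭ f p = sum-↭ (map⁺ f p)

∑-≥-∈ : ∀ {xs c} (f : ℕ → ℕ) → c ∈ xs → f c ≤ ∑ xs f
∑-≥-∈ {x ∷ xs} f (here refl) = m≤m+n (f x) (∑ xs f)
∑-≥-∈ {x ∷ xs} f (there c∈)  = ≤-trans (∑-≥-∈ f c∈) (m≤n+m (∑ xs f) (f x))

∑-pos⇒∃ : ∀ xs (f : ℕ → ℕ) → 0 < ∑ xs f → ∃ λ x → x ∈ xs × 0 < f x
∑-pos⇒∃ (x ∷ xs) f pos with f x in eq
... | suc _ = x , here refl , subst (0 <_) (sym eq) z<s
... | zero  with ∑-pos⇒∃ xs f pos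
...   | y , y∈ , fy>0 = y , there y∈ , fy>0

𝟙 : ∀ {p} {P : Set p} → Dec P → ℕ
𝟙 (yes _) = 1
𝟙 (no _)  = 0

module _ {p} {P : Set p} where

  𝟙-yes : (P? : Dec P) → P → 𝟙 P? ≡ 1
  𝟙-yes (yes _) _  = refl
  𝟙-yes (no ¬P) pr = contradiction pr ¬P

  𝟙-no : (P? : Dec P) → ¬ P → 𝟙 P? ≡ 0
  𝟙-no (yes pr) ¬P = contradiction pr ¬P
  𝟙-no (no _)   _  = refl

  𝟙≤1 : (P? : Dec P) → 𝟙 P? ≤ 1
  𝟙≤1 (yes _) = s≤s z≤n
  𝟙≤1 (no _)  = z≤n

  𝟙-pos⇒ : (P? : Dec P) → 0 < 𝟙 P? → P
  𝟙-pos⇒ (yes pr) _ = pr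

𝟙-⇔ : ∀ {p q} {P : Set p} {Q : Set q} → P ⇔ Q → (P? : Dec P) (Q? : Dec Q) → 𝟙 P? ≡ 𝟙 Q?
𝟙-⇔ P⇔Q (yes pr) Q? = sym (𝟙-yes Q? (Equivalence.to P⇔Q pr))
𝟙-⇔ P⇔Q (no ¬P)  Q? = sym (𝟙-no Q? (¬P ∘ Equivalence.from P⇔Q))

module _ {p q} {P : Set p} {Q : Set q} (P? : Dec P) (Q? : Dec Q) where

  𝟙+𝟙≥1 : P ⊎ Q → 1 ≤ 𝟙 P? + 𝟙 Q?
  𝟙+𝟙≥1 (inj₁ pr) = subst (λ t → 1 ≤ t + 𝟙 Q?) (sym (𝟙-yes P? pr)) (s≤s z≤n)
  𝟙+𝟙≥1 (inj₂ qr) = subst (λ t → 1 ≤ 𝟙 P? + t) (sym (𝟙-yes Q? qr)) (m≤n+m 1 (𝟙 P?))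

  𝟙+𝟙≡2 : P → Q → 𝟙 P? + 𝟙 Q? ≡ 2
  𝟙+𝟙≡2 pr qr = cong₂ _+_ (𝟙-yes P? pr) (𝟙-yes Q? qr)

≤𝟙+𝟙 : ∀ {p q} {P : Set p} {Q : Set q} {m} (P? : Dec P) (Q? : Dec Q) →
  m ≤ 1 → (0 < m → P ⊎ Q) → m ≤ 𝟙 P? + 𝟙 Q?
≤𝟙+𝟙 {m = zero}  P? Q? _   _       = z≤n
≤𝟙+𝟙 {m = suc _} P? Q? m≤1 P-or-Q = ≤-trans m≤1 (𝟙+𝟙≥1 P? Q? (P-or-Q z<s))

∑-≤-single-support : ∀ {xs} (f : ℕ → ℕ) {c} → Unique xs →
  (∀ {x x′} → x ∈ xs → x′ ∈ xs → 0 < f x → 0 < f x′ → x ≡ x′) →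
  (∀ {x} → x ∈ xs → f x ≤ c) → ∑ xs f ≤ c
∑-≤-single-support {[]}     f u single bnd = z≤n
∑-≤-single-support {x ∷ xs} f {c} (x∉xs ∷ u) single bnd with f x ≟ 0
... | yes fx≡0 = subst (_≤ c) (cong (_+ ∑ xs f) (sym fx≡0))
  (∑-≤-single-support f u (λ p q → single (there p) (there q)) (bnd ∘ there))
... | no fx≢0 =
  subst (_≤ c) (sym (trans (cong (f x +_) rest≡0) (+-identityʳ (f x)))) (bnd (here refl))
  where
  rest≡0 : ∑ xs f ≡ 0
  rest≡0 = n≤0⇒n≡0 (∑-≤-single-support f u (λ p q → single (there p) (there q))
             (λ {x′} x′∈ → ≮⇒≥ λ fx′>0 →
               All.lookup x∉xs x′∈ (single (here refl) (there x′∈) (n≢0⇒n>0 fx≢0) fx′>0)))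

count-≡≤1 : ∀ {xs} c → Unique xs → ∑[ x ∈ xs ] 𝟙 (x ≟ c) ≤ 1
count-≡≤1 c u = ∑-≤-single-support (λ x → 𝟙 (x ≟ c)) u
  (λ {x} {x′} _ _ p q → trans (𝟙-pos⇒ (x ≟ c) p) (sym (𝟙-pos⇒ (x′ ≟ c) q)))
  (λ {x} _ → 𝟙≤1 (x ≟ c))

count-∈?≤length : ∀ {xs} A → Unique xs → ∑[ v ∈ xs ] 𝟙 (v ∈? A) ≤ length A
count-∈?≤length {xs} A uxs = begin
  ∑[ v ∈ xs ] 𝟙 (v ∈? A)               ≤⟨ ∑-mono-≤ xs (λ {v} _ → member≤ v) ⟩
  ∑[ v ∈ xs ] ∑[ a ∈ A ] 𝟙 (v ≟ a)     ≡⟨ ∑-comm xs A (λ v a → 𝟙 (v ≟ a)) ⟩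
  ∑[ a ∈ A ] ∑[ v ∈ xs ] 𝟙 (v ≟ a)     ≤⟨ ∑-mono-≤ A (λ {a} _ → count-≡≤1 a uxs) ⟩
  ∑[ a ∈ A ] 1                         ≡⟨ trans (∑-const A 1) (*-identityʳ (length A)) ⟩
  length A                             ∎
  where
  open ≤-Reasoning
  member≤ : ∀ v → 𝟙 (v ∈? A) ≤ ∑[ a ∈ A ] 𝟙 (v ≟ a)
  member≤ v with v ∈? A
  ... | no _    = z≤n
  ... | yes v∈A =
    subst (_≤ ∑[ a ∈ A ] 𝟙 (v ≟ a)) (𝟙-yes (v ≟ v) refl) (∑-≥-∈ (λ a → 𝟙 (v ≟ a)) v∈A)

module _ {p q} {P : Pred ℕ p} {Q : Pred ℕ q} (P? : Decidable P) (Q? : Decidable Q) where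

  open Equivalence

  filter-≐-on : ∀ {xs} → (∀ {x} → x ∈ xs → P x ⇔ Q x) → filter P? xs ≡ filter Q? xs
  filter-≐-on {[]}     agree = refl
  filter-≐-on {x ∷ xs} agree with P? x | Q? x
  ... | yes _  | yes _  = cong (x ∷_) (filter-≐-on (agree ∘ there))
  ... | no _   | no _   = filter-≐-on (agree ∘ there)
  ... | yes px | no ¬qx = contradiction (to (agree (here refl)) px) ¬qx
  ... | no ¬px | yes qx = contradiction (from (agree (here refl)) qx) ¬px

  filter-extract : ∀ {xs c} → Unique xs → c ∈ xs → P c → ¬ Q c →
    (∀ {x} → x ∈ xs → x ≢ c → P x ⇔ Q x) → filter P? xs ↭ c ∷ filter Q? xs
  filter-extract {c ∷ xs} (c∉xs ∷ _) (here refl) Pc ¬Qc agree with P? c | Q? c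
  ... | no ¬Pc | _      = contradiction Pc ¬Pc
  ... | yes _  | yes Qc = contradiction Qc ¬Qc
  ... | yes _  | no _   = ↭-prep c (↭-reflexive (filter-≐-on λ x∈ →
                            agree (there x∈) (≢-sym (All.lookup c∉xs x∈))))
  filter-extract {x ∷ xs} {c} (x∉xs ∷ u) (there c∈) Pc ¬Qc agree with P? x | Q? x
  ... | yes _  | yes _  =
    ↭-trans (↭-prep x (filter-extract u c∈ Pc ¬Qc (agree ∘ there))) (↭-swap x c ↭-refl)
  ... | no _   | no _   = filter-extract u c∈ Pc ¬Qc (agree ∘ there)
  ... | yes px | no ¬qx = contradiction (to (agree (here refl) (All.lookup x∉xs c∈)) px) ¬qx
  ... | no ¬px | yes qx = contradiction (from (agree (here refl) (All.lookup x∉xs c∈)) qx) ¬px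

_∩[_,_] : List ℕ → ℕ → ℕ → List ℕ
A ∩[ lo , hi ] = filter (λ x → (lo ≤? x) ×-dec (x ≤? hi)) A

module _ {A : List ℕ} {lo hi : ℕ} where

  ∩-shrinkˡ : ∀ {x} → x ≢ lo → (lo ≤ x × x ≤ hi) ⇔ (suc lo ≤ x × x ≤ hi)
  ∩-shrinkˡ x≢lo = mk⇔ (λ (lo≤x , x≤hi) → ≤∧≢⇒< lo≤x (≢-sym x≢lo) , x≤hi)
                       (λ (lo<x , x≤hi) → <⇒≤ lo<x , x≤hi)

  ∩-peelˡ : Unique A → lo ∈ A → lo ≤ hi → A ∩[ lo , hi ] ↭ lo ∷ A ∩[ suc lo , hi ]
  ∩-peelˡ u lo∈A lo≤hi =
    filter-extract _ _ u lo∈A (≤-refl , lo≤hi) (λ (lo<lo , _) → <-irrefl refl lo<lo) (λ _ → ∩-shrinkˡ)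

  ∩-skipˡ : lo ∉ A → A ∩[ lo , hi ] ≡ A ∩[ suc lo , hi ]
  ∩-skipˡ lo∉A = filter-≐-on _ _ {A} λ x∈A → ∩-shrinkˡ λ { refl → lo∉A x∈A }

  ∩-shrinkʳ : ∀ {x} → x ≢ suc hi → (lo ≤ x × x ≤ suc hi) ⇔ (lo ≤ x × x ≤ hi)
  ∩-shrinkʳ x≢hi = mk⇔ (λ (lo≤x , x≤hi) → lo≤x , s≤s⁻¹ (≤∧≢⇒< x≤hi x≢hi))
                       (λ (lo≤x , x≤hi) → lo≤x , m≤n⇒m≤1+n x≤hi)

  ∩-peelʳ : Unique A → suc hi ∈ A → lo ≤ suc hi → A ∩[ lo , suc hi ] ↭ suc hi ∷ A ∩[ lo , hi ]
  ∩-peelʳ u hi∈A lo≤hi =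
    filter-extract _ _ u hi∈A (lo≤hi , ≤-refl) (λ (_ , hi<hi) → <-irrefl refl hi<hi) (λ _ → ∩-shrinkʳ)

  ∩-skipʳ : suc hi ∉ A → A ∩[ lo , suc hi ] ≡ A ∩[ lo , hi ]
  ∩-skipʳ hi∉A = filter-≐-on _ _ {A} λ x∈A → ∩-shrinkʳ λ { refl → hi∉A x∈A }

∩-empty : ∀ A {lo hi} → hi < lo → A ∩[ lo , hi ] ≡ []
∩-empty A hi<lo =
  filter-none _ (All.universal (λ _ (lo≤x , x≤hi) → <⇒≱ hi<lo (≤-trans lo≤x x≤hi)) A)

module _ (A : List ℕ) {lo hi : ℕ} where

  ∈-∩⁻ : ∀ {x} → x ∈ A ∩[ lo , hi ] → lo ≤ x × x ≤ hi
  ∈-∩⁻ = proj₂ ∘ ∈-filter⁻ (λ x → (lo ≤? x) ×-dec (x ≤? hi)) {xs = A}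

  ∈-∩⁺ : ∀ {x} → x ∈ A → lo ≤ x → x ≤ hi → x ∈ A ∩[ lo , hi ]
  ∈-∩⁺ x∈A lo≤x x≤hi = ∈-filter⁺ (λ x → (lo ≤? x) ×-dec (x ≤? hi)) x∈A (lo≤x , x≤hi)

∩-all : ∀ {A n} → All (_≤ n) A → A ∩[ 0 , n ] ≡ A
∩-all A≤n = filter-all _ (All.map (z≤n ,_) A≤n)

∣-∣≤ : ∀ {x z d} → x ≤ z + d → z ≤ x + d → ∣ x - z ∣ ≤ d
∣-∣≤ {x} {z} x≤z+d z≤x+d with ∣m-n∣≡[m∸n]∨[n∸m] x z
... | inj₁ eq = subst (_≤ _) (sym eq) (m≤n+o⇒m∸n≤o x z x≤z+d)
... | inj₂ eq = subst (_≤ _) (sym eq) (m≤n+o⇒m∸n≤o z x z≤x+d)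

straddle : ∀ {lo x hi} a b → lo ≤ x → x ≤ hi → hi ≤ lo + a + b →
  ∣ lo - x ∣ ≤ a ⊎ ∣ hi - x ∣ ≤ b
straddle {lo} {x} {hi} a b lo≤x x≤hi hi≤ with x ≤? lo + a
... | yes x≤lo+a = inj₁ (∣-∣≤ (≤-trans lo≤x (m≤m+n x a)) x≤lo+a)
... | no  x≰lo+a =
  inj₂ (∣-∣≤ (≤-trans hi≤ (+-monoˡ-≤ b (<⇒≤ (≰⇒> x≰lo+a)))) (≤-trans x≤hi (m≤m+n hi b)))

module PairWeight (a b : ℕ) where

  w : ℕ → ℕ
  w d = 𝟙 (d ≤? a) + 𝟙 (d ≤? b)

  mass : List ℕ → ℕ
  mass S = ∑[ x ∈ S ] ∑[ z ∈ S ] w ∣ x - z ∣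

  mass-∷ : ∀ c S → mass (c ∷ S) ≡ 2 + 2 * ∑[ x ∈ S ] w ∣ c - x ∣ + mass S
  mass-∷ c S = begin
    w ∣ c - c ∣ + D + ∑[ x ∈ S ] (w ∣ x - c ∣ + ∑[ z ∈ S ] w ∣ x - z ∣)
      ≡⟨ cong₂ _+_ (cong (λ t → w t + D) (∣n-n∣≡0 c)) refl ⟩
    2 + D + ∑[ x ∈ S ] (w ∣ x - c ∣ + ∑[ z ∈ S ] w ∣ x - z ∣)
      ≡⟨ cong (2 + D +_) (∑-+ S (λ x → w ∣ x - c ∣) (λ x → ∑[ z ∈ S ] w ∣ x - z ∣)) ⟩
    2 + D + (∑[ x ∈ S ] w ∣ x - c ∣ + mass S)
      ≡⟨ cong (λ t → 2 + D + (t + mass S)) (∑-cong S λ {x} _ → cong w (∣-∣-comm x c)) ⟩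
    2 + D + (D + mass S)
      ≡⟨ regroup D (mass S) ⟩
    2 + 2 * D + mass S ∎
    where
    open ≡-Reasoning
    D : ℕ
    D = ∑[ x ∈ S ] w ∣ c - x ∣
    regroup : ∀ d m → 2 + d + (d + m) ≡ 2 + 2 * d + m
    regroup = solve-∀

  mass-↭ : ∀ {S S′} → S ↭ S′ → mass S ≡ mass S′
  mass-↭ {S} S↭S′ = trans (∑-cong S λ {x} _ → ∑-↭ (λ z → w ∣ x - z ∣) S↭S′) (∑-↭ _ S↭S′)

  Heavy : List ℕ → Set
  Heavy S = length S * suc (length S) ≤ mass S

  heavy-↭ : ∀ {S S′} → S ↭ S′ → Heavy S′ → Heavy S
  heavy-↭ S↭S′ = subst₂ (λ k m → k * suc k ≤ m) (sym (↭-length S↭S′)) (sym (mass-↭ S↭S′))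

  heavy-∷ : ∀ {c S} → (∀ {x} → x ∈ S → 1 ≤ w ∣ c - x ∣) → Heavy S → Heavy (c ∷ S)
  heavy-∷ {c} {S} near heavy = begin
    suc k * suc (suc k)   ≡⟨ expand k ⟩
    2 + 2 * k + k * suc k ≤⟨ +-mono-≤ (+-monoʳ-≤ 2 (*-monoʳ-≤ 2 k≤D)) heavy ⟩
    2 + 2 * D + mass S    ≡⟨ sym (mass-∷ c S) ⟩
    mass (c ∷ S)          ∎
    where
    open ≤-Reasoning
    k D : ℕ
    k = length S
    D = ∑[ x ∈ S ] w ∣ c - x ∣
    k≤D : k ≤ D
    k≤D = subst (_≤ D) (trans (∑-const S 1) (*-identityʳ k)) (∑-mono-≤ S near)
    expand : ∀ k → suc k * suc (suc k) ≡ 2 + 2 * k + k * suc k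
    expand = solve-∀

  heavy-∷∷ : ∀ {c c′ S} → 2 * length S + 1 ≤ ∑[ x ∈ S ] (w ∣ c - x ∣ + w ∣ c′ - x ∣) →
    Heavy S → Heavy (c ∷ c′ ∷ S)
  heavy-∷∷ {c} {c′} {S} balanced heavy = begin
    suc (suc k) * suc (suc (suc k)) ≡⟨ expand k ⟩
    4 + 2 * (2 * k + 1) + k * suc k
      ≤⟨ +-mono-≤ (+-monoʳ-≤ 4 (*-monoʳ-≤ 2 2k+1≤D+D′)) heavy ⟩
    4 + 2 * (D + D′) + mass S       ≡⟨ regroup D D′ (mass S) ⟩
    2 + 2 * D + (2 + 2 * D′ + mass S)
      ≤⟨ +-monoˡ-≤ _ (+-monoʳ-≤ 2 (*-monoʳ-≤ 2 (m≤n+m D (w ∣ c - c′ ∣)))) ⟩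
    2 + 2 * (w ∣ c - c′ ∣ + D) + (2 + 2 * D′ + mass S)
      ≡⟨ sym (trans (mass-∷ c (c′ ∷ S)) (cong (2 + 2 * (w ∣ c - c′ ∣ + D) +_) (mass-∷ c′ S))) ⟩
    mass (c ∷ c′ ∷ S) ∎
    where
    open ≤-Reasoning
    k D D′ : ℕ
    k  = length S
    D  = ∑[ x ∈ S ] w ∣ c - x ∣
    D′ = ∑[ x ∈ S ] w ∣ c′ - x ∣
    2k+1≤D+D′ : 2 * k + 1 ≤ D + D′
    2k+1≤D+D′ = subst (2 * k + 1 ≤_) (∑-+ S (λ x → w ∣ c - x ∣) (λ x → w ∣ c′ - x ∣)) balanced
    expand : ∀ k → suc (suc k) * suc (suc (suc k)) ≡ 4 + 2 * (2 * k + 1) + k * suc k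
    expand = solve-∀
    regroup : ∀ d d′ m → 4 + 2 * (d + d′) + m ≡ 2 + 2 * d + (2 + 2 * d′ + m)
    regroup = solve-∀

  w-pos : ∀ {d} → d ≤ a ⊎ d ≤ b → 1 ≤ w d
  w-pos {d} = 𝟙+𝟙≥1 (d ≤? a) (d ≤? b)

  module Peeling {A : List ℕ} {y : ℕ} (uA : Unique A) (y∈A : y ∈ A)
                 (near : ∀ {x} → x ∈ A → y ≤ x + a × x ≤ y + b) where

    around : ∀ {lo hi x} → lo ∈ A → hi ∈ A → lo ≤ x → x ≤ hi →
      2 + 𝟙 (x ≟ y) ≤ w ∣ hi - x ∣ + w ∣ lo - x ∣
    around {lo} {hi} {x} lo∈A hi∈A lo≤x x≤hi =
      subst₂ _≤_ (+-comm (1 + 𝟙 (x ≟ y)) 1) (interchange p q r s) (+-mono-≤ outer inner)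
      where
      p q r s : ℕ
      p = 𝟙 (∣ lo - x ∣ ≤? a)
      q = 𝟙 (∣ lo - x ∣ ≤? b)
      r = 𝟙 (∣ hi - x ∣ ≤? a)
      s = 𝟙 (∣ hi - x ∣ ≤? b)
      hi≤lo+a+b : hi ≤ lo + a + b
      hi≤lo+a+b = ≤-trans (proj₂ (near hi∈A)) (+-monoˡ-≤ b (proj₁ (near lo∈A)))
      hi≤lo+b+a : hi ≤ lo + b + a
      hi≤lo+b+a = subst (hi ≤_) (swap-last lo a b) hi≤lo+a+b
        where
        swap-last : ∀ l a b → l + a + b ≡ l + b + a
        swap-last = solve-∀
      outer : 1 + 𝟙 (x ≟ y) ≤ p + s
      outer with x ≟ y
      ... | no _     =
        𝟙+𝟙≥1 (∣ lo - x ∣ ≤? a) (∣ hi - x ∣ ≤? b) (straddle a b lo≤x x≤hi hi≤lo+a+b)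
      ... | yes refl = ≤-reflexive (sym (𝟙+𝟙≡2 (∣ lo - x ∣ ≤? a) (∣ hi - x ∣ ≤? b)
                        (∣-∣≤ (≤-trans lo≤x (m≤m+n _ a)) (proj₁ (near lo∈A)))
                        (∣-∣≤ (proj₂ (near hi∈A)) (≤-trans x≤hi (m≤m+n hi b)))))
      inner : 1 ≤ q + r
      inner = 𝟙+𝟙≥1 (∣ lo - x ∣ ≤? b) (∣ hi - x ∣ ≤? a) (straddle b a lo≤x x≤hi hi≤lo+b+a)
      interchange : ∀ p q r s → p + s + (q + r) ≡ r + s + (p + q)
      interchange = solve-∀

    balanced : ∀ {lo hi S} → lo ∈ A → hi ∈ A → y ∈ S → (∀ {x} → x ∈ S → lo ≤ x × x ≤ hi) →
      2 * length S + 1 ≤ ∑[ x ∈ S ] (w ∣ hi - x ∣ + w ∣ lo - x ∣)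
    balanced {lo} {hi} {S} lo∈A hi∈A y∈S inside = begin
      2 * length S + 1                       ≤⟨ +-monoʳ-≤ (2 * length S) one≤ ⟩
      2 * length S + ∑[ x ∈ S ] 𝟙 (x ≟ y)    ≡⟨ cong₂ _+_ (*-comm 2 (length S)) refl ⟩
      length S * 2 + ∑[ x ∈ S ] 𝟙 (x ≟ y)    ≡⟨ cong₂ _+_ (sym (∑-const S 2)) refl ⟩
      ∑[ x ∈ S ] 2 + ∑[ x ∈ S ] 𝟙 (x ≟ y)    ≡⟨ sym (∑-+ S (λ _ → 2) (λ x → 𝟙 (x ≟ y))) ⟩
      ∑[ x ∈ S ] (2 + 𝟙 (x ≟ y))             ≤⟨ ∑-mono-≤ S (λ x∈S → let lo≤x , x≤hi = inside x∈S in
                                                                around lo∈A hi∈A lo≤x x≤hi) ⟩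
      ∑[ x ∈ S ] (w ∣ hi - x ∣ + w ∣ lo - x ∣) ∎
      where
      open ≤-Reasoning
      one≤ : 1 ≤ ∑[ x ∈ S ] 𝟙 (x ≟ y)
      one≤ = subst (_≤ ∑[ x ∈ S ] 𝟙 (x ≟ y)) (𝟙-yes (y ≟ y) refl) (∑-≥-∈ (λ x → 𝟙 (x ≟ y)) y∈S)

    heavy-centre : Heavy (A ∩[ y , y ])
    heavy-centre = heavy-↭ (∩-peelˡ uA y∈A ≤-refl)
      (subst (λ S → Heavy (y ∷ S)) (sym (∩-empty A ≤-refl)) (heavy-∷ {c = y} {S = []} (λ ()) z≤n))

    fuel-suc : ∀ {d lo hi} → hi ≤ suc d + lo → hi ≤ d + suc lo
    fuel-suc {d} {lo} {hi} = subst (hi ≤_) (sym (+-suc d lo))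

    below-top : ∀ {h} → y ≤ suc h → suc h ≢ y → y ≤ h
    below-top y≤hi hi≢y = s≤s⁻¹ (≤∧≢⇒< y≤hi (≢-sym hi≢y))

    heavy-degenerate : ∀ {lo hi} → lo ≤ y → y ≤ hi → hi ≤ lo → Heavy (A ∩[ lo , hi ])
    heavy-degenerate lo≤y y≤hi hi≤lo
      with ≤-antisym lo≤y (≤-trans y≤hi hi≤lo) | ≤-antisym (≤-trans hi≤lo lo≤y) y≤hi
    ... | refl | refl = heavy-centre

    peel-top : ∀ {h} → suc h ∈ A → y ≤ h → Heavy (A ∩[ y , h ]) → Heavy (A ∩[ y , suc h ])
    peel-top {h} hi∈A y≤h = heavy-↭ (∩-peelʳ uA hi∈A (m≤n⇒m≤1+n y≤h)) ∘ heavy-∷ close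
      where
      close : ∀ {x} → x ∈ A ∩[ y , h ] → 1 ≤ w ∣ suc h - x ∣
      close x∈ = let y≤x , x≤h = ∈-∩⁻ A x∈ in w-pos (inj₂ (∣-∣≤
        (≤-trans (proj₂ (near hi∈A)) (+-monoˡ-≤ b y≤x)) (≤-trans (m≤n⇒m≤1+n x≤h) (m≤m+n (suc h) b))))

    peel-bottom : ∀ {lo} → lo ∈ A → lo < y → Heavy (A ∩[ suc lo , y ]) → Heavy (A ∩[ lo , y ])
    peel-bottom {lo} lo∈A lo<y = heavy-↭ (∩-peelˡ uA lo∈A (<⇒≤ lo<y)) ∘ heavy-∷ close
      where
      close : ∀ {x} → x ∈ A ∩[ suc lo , y ] → 1 ≤ w ∣ lo - x ∣
      close x∈ = let lo<x , x≤y = ∈-∩⁻ A x∈ in w-pos (inj₁ (∣-∣≤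
        (≤-trans (<⇒≤ lo<x) (m≤m+n _ a)) (≤-trans x≤y (proj₁ (near lo∈A)))))

    peel-both : ∀ {lo h} → lo ∈ A → suc h ∈ A → lo < y → y ≤ h →
      Heavy (A ∩[ suc lo , h ]) → Heavy (A ∩[ lo , suc h ])
    peel-both {lo} {h} lo∈A hi∈A lo<y y≤h =
      heavy-↭ (↭-trans (∩-peelʳ uA hi∈A (m≤n⇒m≤1+n lo≤h)) (↭-prep (suc h) (∩-peelˡ uA lo∈A lo≤h)))
      ∘ heavy-∷∷ {c = suc h} {c′ = lo} {S = A ∩[ suc lo , h ]}
          (balanced lo∈A hi∈A (∈-∩⁺ A y∈A lo<y y≤h) inside)
      where
      lo≤h : lo ≤ h
      lo≤h = ≤-trans (<⇒≤ lo<y) y≤h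
      inside : ∀ {x} → x ∈ A ∩[ suc lo , h ] → lo ≤ x × x ≤ suc h
      inside x∈ = let lo<x , x≤h = ∈-∩⁻ A x∈ in <⇒≤ lo<x , m≤n⇒m≤1+n x≤h

    heavy-∩ : ∀ d {lo hi} → hi ≤ d + lo → lo ≤ y → y ≤ hi → Heavy (A ∩[ lo , hi ])
    heavy-∩ zero              hi≤lo lo≤y y≤hi = heavy-degenerate lo≤y y≤hi hi≤lo
    heavy-∩ (suc d) {lo} {hi} fuel  lo≤y y≤hi with lo <? hi
    ... | no lo≮hi = heavy-degenerate lo≤y y≤hi (≮⇒≥ lo≮hi)
    heavy-∩ (suc d) {lo} {suc h} fuel lo≤y y≤hi | yes (s≤s lo≤h)
      with lo ∈? A | suc h ∈? A | lo ≟ y | suc h ≟ y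
    ... | no lo∉A  | _        | _        | _ =
      subst Heavy (sym (∩-skipˡ lo∉A))
        (heavy-∩ d (fuel-suc fuel) (≤∧≢⇒< lo≤y λ { refl → lo∉A y∈A }) y≤hi)
    ... | yes _    | no hi∉A  | _        | _ =
      subst Heavy (sym (∩-skipʳ hi∉A))
        (heavy-∩ d (s≤s⁻¹ fuel) lo≤y (below-top y≤hi λ hi≡y → hi∉A (subst (_∈ A) (sym hi≡y) y∈A)))
    ... | yes _    | yes hi∈A | yes refl | _ =
      peel-top hi∈A lo≤h (heavy-∩ d (s≤s⁻¹ fuel) lo≤y lo≤h)
    ... | yes lo∈A | yes _    | no lo≢y  | yes hi≡y =
      subst (λ t → Heavy (A ∩[ lo , t ])) (sym hi≡y)
        (peel-bottom lo∈A (≤∧≢⇒< lo≤y lo≢y)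
          (heavy-∩ d (subst (_≤ d + suc lo) hi≡y (fuel-suc fuel)) (≤∧≢⇒< lo≤y lo≢y) ≤-refl))
    ... | yes lo∈A | yes hi∈A | no lo≢y  | no hi≢y =
      peel-both lo∈A hi∈A (≤∧≢⇒< lo≤y lo≢y) (below-top y≤hi hi≢y)
        (heavy-∩ d (≤-trans (s≤s⁻¹ fuel) (+-monoʳ-≤ d (n≤1+n lo)))
          (≤∧≢⇒< lo≤y lo≢y) (below-top y≤hi hi≢y))

  heavy : ∀ {A y} → Unique A → y ∈ A → (∀ {x} → x ∈ A → y ≤ x + a × x ≤ y + b) → Heavy A
  heavy {A} {y} uA y∈A near = subst Heavy (∩-all (All.tabulate (proj₂ ∘ near)))
    (heavy-∩ (y + b) (≤-reflexive (sym (+-identityʳ (y + b)))) z≤n (m≤m+n y b))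
    where open Peeling uA y∈A near

window : ℕ → ℕ → ℕ → ℕ → ℕ
window n y x z = 𝟙 ((z ≤? x + y) ×-dec (x + y ≤? z + n))

module _ {n y : ℕ} (y≤n : y ≤ n) where

  open PairWeight y (n ∸ y)

  window-shift : ∀ z d → window n y (z + d) z + window n y z (z + d) ≡ w d
  window-shift z d =
    trans (cong₂ _+_ larger-first smaller-first) (+-comm (𝟙 (d ≤? n ∸ y)) (𝟙 (d ≤? y)))
    where
    larger-first : window n y (z + d) z ≡ 𝟙 (d ≤? n ∸ y)
    larger-first = 𝟙-⇔ (mk⇔
      (λ (_ , le) → m+n≤o⇒m≤o∸n d (+-cancelˡ-≤ z _ _ (subst (_≤ z + n) (+-assoc z d y) le)))
      (λ le → subst (z ≤_) (sym (+-assoc z d y)) (m≤m+n z (d + y)) ,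
              subst (_≤ z + n) (sym (+-assoc z d y)) (+-monoʳ-≤ z (m≤o∸n⇒m+n≤o d y≤n le))))
      _ (d ≤? n ∸ y)
    smaller-first : window n y z (z + d) ≡ 𝟙 (d ≤? y)
    smaller-first = 𝟙-⇔ (mk⇔
      (λ (le , _) → +-cancelˡ-≤ z _ _ le)
      (λ le → +-monoʳ-≤ z le ,
              subst (z + y ≤_) (sym (+-assoc z d n)) (+-monoʳ-≤ z (≤-trans y≤n (m≤n+m n d)))))
      _ (d ≤? y)

  window-symmetrised : ∀ x z → window n y x z + window n y z x ≡ w ∣ x - z ∣
  window-symmetrised x z with ≤-total z x
  ... | inj₁ z≤x with d , refl ← m≤n⇒∃[o]m+o≡n z≤x =
    trans (window-shift z d) (cong w (sym (trans (∣-∣-comm (z + d) z) (∣m-m+n∣≡n z d))))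
  ... | inj₂ x≤z with d , refl ← m≤n⇒∃[o]m+o≡n x≤z =
    trans (+-comm (window n y x (x + d)) _) (trans (window-shift x d) (cong w (sym (∣m-m+n∣≡n x d))))

  mass≡window : ∀ A → mass A ≡ 2 * ∑[ x ∈ A ] ∑[ z ∈ A ] window n y x z
  mass≡window A = begin
    ∑[ x ∈ A ] ∑[ z ∈ A ] w ∣ x - z ∣
      ≡⟨ ∑-cong A (λ {x} _ → ∑-cong A λ {z} _ → sym (window-symmetrised x z)) ⟩
    ∑[ x ∈ A ] ∑[ z ∈ A ] (window n y x z + window n y z x)
      ≡⟨ ∑-cong A (λ {x} _ → ∑-+ A (window n y x) (λ z → window n y z x)) ⟩
    ∑[ x ∈ A ] (∑[ z ∈ A ] window n y x z + ∑[ z ∈ A ] window n y z x)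
      ≡⟨ ∑-+ A (λ x → ∑[ z ∈ A ] window n y x z) (λ x → ∑[ z ∈ A ] window n y z x) ⟩
    W + ∑[ x ∈ A ] ∑[ z ∈ A ] window n y z x
      ≡⟨ cong (W +_) (∑-comm A A (λ x z → window n y z x)) ⟩
    W + W
      ≡⟨ cong (W +_) (sym (+-identityʳ W)) ⟩
    2 * W ∎
    where
    open ≡-Reasoning
    W : ℕ
    W = ∑[ x ∈ A ] ∑[ z ∈ A ] window n y x z

triples : ℕ → List ℕ → ℕ
triples n A = ∑[ y ∈ A ] ∑[ x ∈ A ] ∑[ z ∈ A ] window n y x z

triples-lower : ∀ {n A} → Unique A → InRange n A →
  length A * (length A * suc (length A)) ≤ 2 * triples n A
triples-lower {n} {A} uA A≤n = begin
  length A * (length A * suc (length A))       ≡⟨ sym (∑-const A _) ⟩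
  ∑[ y ∈ A ] (length A * suc (length A))       ≤⟨ ∑-mono-≤ A per-centre ⟩
  ∑[ y ∈ A ] (2 * ∑[ x ∈ A ] ∑[ z ∈ A ] window n y x z) ≡⟨ ∑-*ˡ A 2 _ ⟩
  2 * triples n A                              ∎
  where
  open ≤-Reasoning
  per-centre : ∀ {y} → y ∈ A → length A * suc (length A) ≤ 2 * ∑[ x ∈ A ] ∑[ z ∈ A ] window n y x z
  per-centre {y} y∈A = subst (_ ≤_) (mass≡window y≤n A) (PairWeight.heavy y (n ∸ y) uA y∈A near)
    where
    y≤n : y ≤ n
    y≤n = All.lookup A≤n y∈A
    near : ∀ {x} → x ∈ A → y ≤ x + y × x ≤ y + (n ∸ y)
    near x∈A = m≤n+m y _ , subst (_ ≤_) (sym (m+[n∸m]≡n y≤n)) (All.lookup A≤n x∈A)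

reps : List ℕ → ℕ → ℕ
reps A s = ∑[ y ∈ A ] ∑[ x ∈ A ] 𝟙 (x + y ≟ s)

reps-pos⇒ : ∀ A s → 0 < reps A s → ∃₂ λ x y → x ∈ A × y ∈ A × x + y ≡ s
reps-pos⇒ A s pos with ∑-pos⇒∃ A _ pos
... | y , y∈A , pos′ with ∑-pos⇒∃ A _ pos′
... | x , x∈A , pos″ = x , y , x∈A , y∈A , 𝟙-pos⇒ (x + y ≟ s) pos″

count-partner≤1 : ∀ {A} y s → Unique A → ∑[ x ∈ A ] 𝟙 (x + y ≟ s) ≤ 1
count-partner≤1 y s uA = ∑-≤-single-support (λ x → 𝟙 (x + y ≟ s)) uA
  (λ {x} {x′} _ _ p q → +-cancelʳ-≡ y x x′ (trans (𝟙-pos⇒ (x + y ≟ s) p) (sym (𝟙-pos⇒ (x′ + y ≟ s) q))))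
  (λ {x} _ → 𝟙≤1 (x + y ≟ s))

window≤ : ∀ n y x z → window n y x z ≤ ∑[ v ∈ upTo (suc n) ] 𝟙 (x + y ≟ z + v)
window≤ n y x z with (z ≤? x + y) ×-dec (x + y ≤? z + n)
... | no _ = z≤n
... | yes (z≤x+y , x+y≤z+n) = subst (_≤ ∑[ v ∈ upTo (suc n) ] 𝟙 (x + y ≟ z + v))
  (𝟙-yes (x + y ≟ z + (x + y ∸ z)) (sym (m+[n∸m]≡n z≤x+y)))
  (∑-≥-∈ (λ v → 𝟙 (x + y ≟ z + v)) (∈-upTo⁺ (s≤s (m≤n+o⇒m∸n≤o (x + y) z x+y≤z+n))))

module B₃Set {A : List ℕ} (uA : Unique A) (bA : IsB₃ A) where

  isB₂ : ∀ {x y p q} → x ∈ A → y ∈ A → p ∈ A → q ∈ A → x + y ≡ p + q → x ≡ p ⊎ x ≡ q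
  isB₂ {p = p} x∈A y∈A p∈A q∈A eq
    with ∈-resp-↭ (bA x∈A y∈A p∈A p∈A q∈A p∈A (cong (_+ p) eq)) (here refl)
  ... | here x≡p                = inj₁ x≡p
  ... | there (here x≡q)        = inj₂ x≡q
  ... | there (there (here x≡p)) = inj₁ x≡p

  reps≤2 : ∀ s → reps A s ≤ 2
  reps≤2 s with 0 <? reps A s
  ... | no  none = ≤-trans (≮⇒≥ none) z≤n
  ... | yes some with reps-pos⇒ A s some
  ...   | x₀ , y₀ , x₀∈A , y₀∈A , x₀+y₀≡s = begin
    reps A s                                            ≤⟨ ∑-mono-≤ A summand≤ ⟩
    ∑[ y ∈ A ] (𝟙 (y ≟ x₀) + 𝟙 (y ≟ y₀))                ≡⟨ ∑-+ A _ _ ⟩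
    ∑[ y ∈ A ] 𝟙 (y ≟ x₀) + ∑[ y ∈ A ] 𝟙 (y ≟ y₀)       ≤⟨ +-mono-≤ (count-≡≤1 x₀ uA) (count-≡≤1 y₀ uA) ⟩
    2                                                   ∎
    where
    open ≤-Reasoning
    summand≤ : ∀ {y} → y ∈ A → ∑[ x ∈ A ] 𝟙 (x + y ≟ s) ≤ 𝟙 (y ≟ x₀) + 𝟙 (y ≟ y₀)
    summand≤ {y} y∈A = ≤𝟙+𝟙 (y ≟ x₀) (y ≟ y₀) (count-partner≤1 y s uA) λ pos →
      let x , x∈A , pos′ = ∑-pos⇒∃ A _ pos
      in isB₂ y∈A x∈A x₀∈A y₀∈A (trans (+-comm y x) (trans (𝟙-pos⇒ (x + y ≟ s) pos′) (sym x₀+y₀≡s)))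

  shifted-reps-∉ : ∀ {v} → v ∉ A → ∑[ z ∈ A ] reps A (z + v) ≤ 2
  shifted-reps-∉ {v} v∉A =
    ∑-≤-single-support (λ z → reps A (z + v)) uA same (λ {z} _ → reps≤2 (z + v))
    where
    -- B₃ applied to x + y + z′ = x′ + y′ + z puts z among x, y, z′, and z ∈ {x, y} would force v ∈ A.
    same : ∀ {z z′} → z ∈ A → z′ ∈ A → 0 < reps A (z + v) → 0 < reps A (z′ + v) → z ≡ z′
    same {z} {z′} z∈A z′∈A pos pos′
      with x , y , x∈A , y∈A , x+y≡z+v ← reps-pos⇒ A _ pos
         | x′ , y′ , x′∈A , y′∈A , x′+y′≡z′+v ← reps-pos⇒ A _ pos′
      with ∈-resp-↭ (↭-sym (bA x∈A y∈A z′∈A x′∈A y′∈A z∈A balance)) (there (there (here refl)))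
      where
      balance : x + y + z′ ≡ x′ + y′ + z
      balance = begin
        x + y + z′  ≡⟨ cong (_+ z′) x+y≡z+v ⟩
        z + v + z′  ≡⟨ swap-ends z v z′ ⟩
        z′ + v + z  ≡⟨ cong (_+ z) (sym x′+y′≡z′+v) ⟩
        x′ + y′ + z ∎
        where
        open ≡-Reasoning
        swap-ends : ∀ p q r → p + q + r ≡ r + q + p
        swap-ends = solve-∀
    ... | here z≡x =
      contradiction (subst (_∈ A) (+-cancelˡ-≡ x y v (trans x+y≡z+v (cong (_+ v) z≡x))) y∈A) v∉A
    ... | there (here z≡y) =
      contradiction (subst (_∈ A) (+-cancelʳ-≡ y x v (trans x+y≡z+v (trans (cong (_+ v) z≡y) (+-comm y v))))
                      x∈A) v∉A
    ... | there (there (here z≡z′)) = z≡z′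

  shifted-reps≤ : ∀ v → ∑[ z ∈ A ] reps A (z + v) ≤ 2 + 2 * (length A ∸ 1) * 𝟙 (v ∈? A)
  shifted-reps≤ v with v ∈? A
  ... | no v∉A = ≤-trans (shifted-reps-∉ v∉A) (m≤m+n 2 _)
  ... | yes v∈A = begin
    ∑[ z ∈ A ] reps A (z + v)   ≤⟨ ∑-mono-≤ A (λ {z} _ → reps≤2 (z + v)) ⟩
    ∑[ z ∈ A ] 2                ≡⟨ ∑-const A 2 ⟩
    length A * 2                ≡⟨ nonempty (length A) (length-pos v∈A) ⟩
    2 + 2 * (length A ∸ 1) * 1  ∎
    where
    open ≤-Reasoning
    length-pos : ∀ {xs : List ℕ} {x} → x ∈ xs → 0 < length xs
    length-pos (here _)  = z<s
    length-pos (there _) = z<s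
    nonempty : ∀ k → 0 < k → k * 2 ≡ 2 + 2 * (k ∸ 1) * 1
    nonempty (suc k) _ = shape k
      where
      shape : ∀ k → suc k * 2 ≡ 2 + 2 * k * 1
      shape = solve-∀

  triples-upper : ∀ n → triples n A ≤ 2 * suc n + 2 * (length A ∸ 1) * length A
  triples-upper n = begin
    triples n A
      ≤⟨ ∑-mono-≤ A (λ {y} _ → ∑-mono-≤ A λ {x} _ → ∑-mono-≤ A λ {z} _ → window≤ n y x z) ⟩
    ∑[ y ∈ A ] ∑[ x ∈ A ] ∑[ z ∈ A ] ∑[ v ∈ R ] f y x z v
      ≡⟨ ∑-cong A (λ {y} _ → ∑-cong A λ {x} _ → ∑-comm A R (f y x)) ⟩
    ∑[ y ∈ A ] ∑[ x ∈ A ] ∑[ v ∈ R ] ∑[ z ∈ A ] f y x z v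
      ≡⟨ ∑-cong A (λ {y} _ → ∑-comm A R λ x v → ∑[ z ∈ A ] f y x z v) ⟩
    ∑[ y ∈ A ] ∑[ v ∈ R ] ∑[ x ∈ A ] ∑[ z ∈ A ] f y x z v
      ≡⟨ ∑-comm A R (λ y v → ∑[ x ∈ A ] ∑[ z ∈ A ] f y x z v) ⟩
    ∑[ v ∈ R ] ∑[ y ∈ A ] ∑[ x ∈ A ] ∑[ z ∈ A ] f y x z v
      ≡⟨ ∑-cong R (λ {v} _ → ∑-cong A λ {y} _ → ∑-comm A A λ x z → f y x z v) ⟩
    ∑[ v ∈ R ] ∑[ y ∈ A ] ∑[ z ∈ A ] ∑[ x ∈ A ] f y x z v
      ≡⟨ ∑-cong R (λ {v} _ → ∑-comm A A λ y z → ∑[ x ∈ A ] f y x z v) ⟩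
    ∑[ v ∈ R ] ∑[ z ∈ A ] reps A (z + v)
      ≤⟨ ∑-mono-≤ R (λ {v} _ → shifted-reps≤ v) ⟩
    ∑[ v ∈ R ] (2 + c * 𝟙 (v ∈? A))
      ≡⟨ ∑-+ R (λ _ → 2) (λ v → c * 𝟙 (v ∈? A)) ⟩
    ∑[ v ∈ R ] 2 + ∑[ v ∈ R ] (c * 𝟙 (v ∈? A))
      ≡⟨ cong₂ _+_ (trans (∑-const R 2) (trans (cong (_* 2) (length-applyUpTo id (suc n))) (*-comm (suc n) 2)))
                   (∑-*ˡ R c (λ v → 𝟙 (v ∈? A))) ⟩
    2 * suc n + c * ∑[ v ∈ R ] 𝟙 (v ∈? A)
      ≤⟨ +-monoʳ-≤ (2 * suc n) (*-monoʳ-≤ c (count-∈?≤length A (upTo⁺ (suc n)))) ⟩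
    2 * suc n + c * length A ∎
    where
    open ≤-Reasoning
    R : List ℕ
    R = upTo (suc n)
    c : ℕ
    c = 2 * (length A ∸ 1)
    f : ℕ → ℕ → ℕ → ℕ → ℕ
    f y x z v = 𝟙 (x + y ≟ z + v)

cube-bound : ∀ k n → 1 ≤ n → k * (k * suc k) ≤ 2 * (2 * suc n + 2 * (k ∸ 1) * k) → (k ∸ 1) ^ 3 ≤ 4 * n
cube-bound zero                n _   _ = z≤n
cube-bound (suc zero)          n _   _ = z≤n
cube-bound (suc (suc zero))    n 1≤n _ = ≤-trans 1≤n (m≤m+n n _)
cube-bound (suc (suc (suc j))) n _   H =
  ≤-trans (m≤m+n (suc (suc j) ^ 3) j)
    (+-cancelʳ-≤ _ _ _ (subst₂ _≤_ (lhs j) (rhs j n) H))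
  where
  -- suc (suc j) ^ 3 appears unfolded, the form the ring solver can read.
  lhs : ∀ j → suc (suc (suc j)) * (suc (suc (suc j)) * suc (suc (suc (suc j))))
              ≡ suc (suc j) * (suc (suc j) * (suc (suc j) * 1)) + j + (4 * (j * j) + 20 * j + 28)
  lhs = solve-∀
  rhs : ∀ j n → 2 * (2 * suc n + 2 * suc (suc j) * suc (suc (suc j)))
              ≡ 4 * n + (4 * (j * j) + 20 * j + 28)
  rhs = solve-∀

corollary1 : (n : ℕ) → 1 ≤ n → (A : List ℕ) → Unique A → InRange n A → IsB₃ A →
    (length A ∸ 1) ^ 3 ≤ 4 * n
corollary1 n 1≤n A uA A≤n bA = cube-bound (length A) n 1≤n
  (≤-trans (triples-lower uA A≤n) (*-monoʳ-≤ 2 (triples-upper n)))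
  where open B₃Set uA bA
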